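{- Let $G$ be a connected graph with diameter $2$ and let $x\in V(G)$ be such that $G-x$ is connected. Then $\mu(G-x)\le\mu(G)$.
   Context: All graphs are finite and simple; $G-x$ is the graph obtained by deleting $x$ and its incident edges. For a connected graph $G$ and $X\subseteq V(G)$, two vertices $u,v$ are $X$-visible if there is a shortest $u,v$-path $P$ in $G$ with $V(P)\cap X\subseteq\{u,v\}$. $X$ is a mutual-visibility set if every two $u,v\in X$ are $X$-visible; $\mu(G)$ is the maximum cardinality of a mutual-visibility set in $G$. -}

module Defs where

open import Data.Nat using (ℕ; zero; suc; _≤_)
open import Data.Bool using (Bool; true; false; T)
open import Data.Fin using (Fin; punchIn)
open import Data.Fin.Subset using (Subset; _∈_; _∉_; ∣_∣)
open import Data.List using (List; []; _∷_)
open import Data.List.Relation.Unary.All using (All)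
open import Data.Product using (Σ; ∃; ∃-syntax; _×_; _,_)
open import Relation.Binary.PropositionalEquality using (_≡_)

record Graph (n : ℕ) : Set where
  field
    adj    : Fin n → Fin n → Bool
    sym    : ∀ u v → adj u v ≡ adj v u
    irrefl : ∀ u → adj u u ≡ false
open Graph public

_─_ : ∀ {n} → Graph (suc n) → Fin (suc n) → Graph n
adj    (G ─ x) u v = adj G (punchIn x u) (punchIn x v)
sym    (G ─ x) u v = sym G (punchIn x u) (punchIn x v)
irrefl (G ─ x) u   = irrefl G (punchIn x u)

data Walk {n} (G : Graph n) : Fin n → Fin n → ℕ → Set where
  nil  : ∀ {u} → Walk G u u 0
  cons : ∀ {u v w k} → T (adj G u v) → Walk G v w k → Walk G u w (suc k)

inner : ∀ {n} {G : Graph n} {u v k} → Walk G u v k → List (Fin n)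
inner nil = []
inner (cons _ nil) = []
inner (cons {v = v} _ (cons h p)) = v ∷ inner (cons h p)

IsShortest : ∀ {n} {G : Graph n} {u v k} → Walk G u v k → Set
IsShortest {G = G} {u} {v} {k} _ = ∀ k' → Walk G u v k' → k ≤ k'

Dist : ∀ {n} → Graph n → Fin n → Fin n → ℕ → Set
Dist G u v k = Σ (Walk G u v k) IsShortest

Connected : ∀ {n} → Graph n → Set
Connected G = ∀ u v → ∃[ k ] Walk G u v k

Diameter2 : ∀ {n} → Graph n → Set
Diameter2 G = (∀ u v → ∃[ k ] (Dist G u v k × k ≤ 2))
            × (∃[ u ] ∃[ v ] Dist G u v 2)

Visible : ∀ {n} → Graph n → Subset n → Fin n → Fin n → Set
Visible G X u v = ∃[ k ] Σ (Walk G u v k) λ p → IsShortest p × All (_∉ X) (inner p)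

MutualVisibility : ∀ {n} → Graph n → Subset n → Set
MutualVisibility G X = ∀ u v → u ∈ X → v ∈ X → Visible G X u v

IsMu : ∀ {n} → Graph n → ℕ → Set
IsMu G m = (∃[ X ] (MutualVisibility G X × ∣ X ∣ ≡ m))
         × (∀ X → MutualVisibility G X → ∣ X ∣ ≤ m)

-- A mutual-visibility set X of G - x is still one in G.  Two of its vertices
-- are at distance at most 2 in G.  If a shortest path between them has length
-- at most 1, or runs through x, it has no inner vertex in X.  Otherwise the
-- two-edge path avoids x, so the shortest path of G - x witnessing their
-- visibility has length at most 2 = d_G(u,v) and stays shortest in G.
module Submission where

open import Defs hiding (sym)
open import Data.Nat using (ℕ; suc; _≤_; z≤n; s≤s)
open import Data.Nat.Properties using (≤-trans)
open import Data.Fin using (Fin; punchIn; punchOut; _≟_)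
open import Data.Fin.Properties using (punchIn-punchOut)
open import Data.Fin.Subset using (Subset; _∈_; _∉_; ∣_∣)
open import Data.Bool using (true; false)
open import Data.Vec using (_∷_; insertAt)
open import Data.Vec.Properties using (insertAt-punchIn; insertAt-lookup; []=⇒lookup; lookup⇒[]=)
open import Data.List using ([]; _∷_; map)
open import Data.List.Relation.Unary.All using (All; []; _∷_)
open import Data.List.Relation.Unary.All.Properties using (gmap⁺)
open import Data.Product using (∃-syntax; _×_; _,_; proj₁)
open import Data.Empty using (⊥-elim)
open import Relation.Nullary using (yes; no)
open import Relation.Binary.PropositionalEquality using (_≡_; refl; sym; trans; cong; subst)

∣insertAt-false∣ : ∀ {n} (X : Subset n) i → ∣ insertAt X i false ∣ ≡ ∣ X ∣
∣insertAt-false∣ X           Fin.zero    = refl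
∣insertAt-false∣ (true ∷ X)  (Fin.suc i) = cong suc (∣insertAt-false∣ X i)
∣insertAt-false∣ (false ∷ X) (Fin.suc i) = ∣insertAt-false∣ X i

i∉insertAt-false : ∀ {n} (X : Subset n) i → i ∉ insertAt X i false
i∉insertAt-false X i i∈ with trans (sym (insertAt-lookup X i false)) ([]=⇒lookup i∈)
... | ()

punchIn-∈-insertAt⁻ : ∀ {n} (X : Subset n) i u → punchIn i u ∈ insertAt X i false → u ∈ X
punchIn-∈-insertAt⁻ X i u u∈ =
  lookup⇒[]= u X (trans (sym (insertAt-punchIn X i false u)) ([]=⇒lookup u∈))

data DeletionView {n} (x : Fin (suc n)) : Fin (suc n) → Set where
  deleted : DeletionView x x
  kept    : ∀ u → DeletionView x (punchIn x u)

deletionView : ∀ {n} (x a : Fin (suc n)) → DeletionView x a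
deletionView x a with x ≟ a
... | yes refl = deleted
... | no x≢a   = subst (DeletionView x) (punchIn-punchOut x≢a) (kept (punchOut x≢a))

visible-≤1 : ∀ {n} {G : Graph n} (X : Subset n) {a b k} (p : Walk G a b k) → IsShortest p → k ≤ 1
           → Visible G X a b
visible-≤1 _ p@nil          p-short _ = _ , p , p-short , []
visible-≤1 _ p@(cons _ nil) p-short _ = _ , p , p-short , []
visible-≤1 _ (cons _ (cons _ _)) _ (s≤s ())

module _ {n} (G : Graph (suc n)) (x : Fin (suc n)) where

  liftWalk : ∀ {u v k} → Walk (G ─ x) u v k → Walk G (punchIn x u) (punchIn x v) k
  liftWalk nil        = nil
  liftWalk (cons e q) = cons e (liftWalk q)

  inner-liftWalk : ∀ {u v k} (q : Walk (G ─ x) u v k) → inner (liftWalk q) ≡ map (punchIn x) (inner q)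
  inner-liftWalk nil                 = refl
  inner-liftWalk (cons _ nil)        = refl
  inner-liftWalk (cons _ (cons e q)) = cong (_ ∷_) (inner-liftWalk (cons e q))

  module _ (X : Subset n) where

    liftVisible : ∀ {u v k} (q : Walk (G ─ x) u v k) → All (_∉ X) (inner q)
                → (∀ k' → Walk G (punchIn x u) (punchIn x v) k' → k ≤ k')
                → Visible G (insertAt X x false) (punchIn x u) (punchIn x v)
    liftVisible q q-avoids q-short =
      _ , liftWalk q , q-short ,
      subst (All _) (sym (inner-liftWalk q))
        (gmap⁺ (λ {w} w∉ w∈ → w∉ (punchIn-∈-insertAt⁻ X x w w∈)) q-avoids)

    visible-within2 : ∀ {u v k} → Visible (G ─ x) X u v
                    → (p : Walk G (punchIn x u) (punchIn x v) k) → IsShortest p → k ≤ 2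
                    → Visible G (insertAt X x false) (punchIn x u) (punchIn x v)
    visible-within2 {k = 0} _ p p-short _ = visible-≤1 _ p p-short z≤n
    visible-within2 {k = 1} _ p p-short _ = visible-≤1 _ p p-short (s≤s z≤n)
    visible-within2 {k = 2} (_ , q , q-short , q-avoids) p@(cons {v = w} e₁ (cons e₂ nil)) p-short _
      with deletionView x w
    ... | deleted = _ , p , p-short , i∉insertAt-false X x ∷ []
    -- once w = punchIn x w', e₁ and e₂ are literally edges of G ─ x
    ... | kept _  = liftVisible q q-avoids
                      (λ k' p' → ≤-trans (q-short 2 (cons e₁ (cons e₂ nil))) (p-short k' p'))
    visible-within2 {k = suc (suc (suc _))} _ _ _ (s≤s (s≤s ()))

    mutualVisibility-insertAt : (∀ a b → ∃[ k ] (Dist G a b k × k ≤ 2))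
                              → MutualVisibility (G ─ x) X
                              → MutualVisibility G (insertAt X x false)
    mutualVisibility-insertAt diam≤2 mv a b a∈ b∈ with deletionView x a | deletionView x b
    ... | deleted | _       = ⊥-elim (i∉insertAt-false X x a∈)
    ... | kept _  | deleted = ⊥-elim (i∉insertAt-false X x b∈)
    ... | kept u  | kept v  with diam≤2 (punchIn x u) (punchIn x v)
    ... | _ , (p , p-short) , k≤2 =
      visible-within2 (mv u v (punchIn-∈-insertAt⁻ X x u a∈) (punchIn-∈-insertAt⁻ X x v b∈))
                      p p-short k≤2

proposition5p6 : ∀ {n} (G : Graph (suc n)) (x : Fin (suc n)) → Connected G → Diameter2 G → Connected (G ─ x) → (m m' : ℕ) → IsMu G m → IsMu (G ─ x) m' → m' ≤ m
proposition5p6 G x _ d2 _ m m' (_ , maximal) ((X , mvX , ∣X∣≡m') , _) =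
  subst (_≤ m) (trans (∣insertAt-false∣ X x) ∣X∣≡m')
    (maximal (insertAt X x false) (mutualVisibility-insertAt G x X (proj₁ d2) mvX))
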